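{- Let $G=(V,E)$ be a finite simple graph which is a rigidity circuit, let $T$ be a coupled spanning tree of $G$, and let $S=E\setminus T$. Fix an orientation of each edge. Then the square integer matrices $C_T=[c^T_{ef}]_{e\in S,\,f\in T}$ and $C_S=[c^S_{fe}]_{f\in T,\,e\in S}$ (each of size $(|V|-1)\times(|V|-1)$) satisfy $C_T=C_S^{ -1}$.
   Context: $K(V)$ is the set of 2-element subsets of $V$. The length-rigidity matroid on $K(V)$: a set $F$ of edges is independent iff the polynomials $(x_v-x_w)^2+(y_v-y_w)^2$, $vw\in F$, are algebraically independent over $\mathbb{Q}$. A rigidity circuit is a graph whose edge set is a minimal dependent set of this matroid (equivalently, $|E|=2|V(E)|-2$ and every proper subset $F\subsetneq E$ satisfies $|F'|\le 2|V(F')|-3$ for all nonempty $F'\subseteq F$, where $V(F')$ is the set of endpoints of edges of $F'$); $V$ is the vertex support of $E$. A coupled spanning tree is an edge set $T\subseteq E$ such that both $T$ and $E\setminus T$ are spanning trees of $V$. For a spanning tree $T$ of $G$ and an oriented edge $e=\langle v,w\rangle\notin T$, let $c^T_{ef}\in\{0,1,-1\}$ for $f\in T$ be defined by: $c^T_{ef}=0$ if $f$ is not on the unique path in $T$ from $v$ to $w$; $c^T_{ef}=1$ if $f$ lies on that path and is traversed in the direction of its orientation when going from $v$ to $w$; $c^T_{ef}=-1$ if it is traversed against its orientation. (Equivalently, the 1-cycle of the polygon in $T\cup\{e\}$ is $-e+\sum_{f\in T}c^T_{ef}f$.) -}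

module Defs where

open import Data.Nat as ℕ using (ℕ; _+_; _≤_)
open import Data.Integer as ℤ using (ℤ; +_; -_)
open import Data.Fin using (Fin; zero; suc)
open import Data.Fin.Properties using () renaming (_≟_ to _≟ᶠ_)
open import Data.Fin.Subset using (Subset; _∈_; _∉_; _⊂_; ⊤; ∣_∣; Nonempty; ∁; inside; outside)
open import Data.Vec using (Vec) renaming (_∷_ to _∷ᵥ_)
open import Data.Vec using ( tabulate; lookup; _[_]≔_)
open import Data.Bool using (Bool; true; false; _∧_; _∨_; if_then_else_)
open import Data.List using (List; []; _∷_)
open import Data.List.Relation.Unary.Unique.Propositional using (Unique)
open import Data.Sum using (_⊎_)
open import Data.Product using (Σ; _×_; proj₁; proj₂; _,_)
open import Relation.Nullary using (¬_)
open import Relation.Nullary.Decidable using (⌊_⌋)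
open import Relation.Binary.PropositionalEquality using (_≡_; _≢_)

-- An oriented graph with vertex set Fin n and m edges indexed by Fin m;
-- edge i goes from  tail i  to  head i  (this is the fixed orientation).
record OGraph (n m : ℕ) : Set where
  field
    ends : Fin m → Fin n × Fin n

  tail head : Fin m → Fin n
  tail i = proj₁ (ends i)
  head i = proj₂ (ends i)

-- finite simple graph: no loops, no two edges with the same unordered pair
-- of endpoints; and V is the vertex support of E (every vertex is an endpoint)
record IsSimpleSupported {n m : ℕ} (G : OGraph n m) : Set where
  open OGraph G
  field
    noLoop   : ∀ i → tail i ≢ head i
    noMulti  : ∀ i j → i ≢ j → ¬ (tail i ≡ tail j × head i ≡ head j)
                              × ¬ (tail i ≡ head j × head i ≡ tail j)
    support  : ∀ v → Σ (Fin m) λ i → (v ≡ tail i) ⊎ (v ≡ head i)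

module _ {n m : ℕ} (G : OGraph n m) where
  open OGraph G

  anyFin : ∀ {k} → (Fin k → Bool) → Bool
  anyFin {ℕ.zero} p = false
  anyFin {ℕ.suc k} p = p zero ∨ anyFin (λ i → p (suc i))

  VS : Subset m → Subset n
  VS F = tabulate λ v → anyFin λ i →
    lookup F i ∧ (⌊ v ≟ᶠ tail i ⌋ ∨ ⌊ v ≟ᶠ head i ⌋)

  -- rigidity circuit (combinatorial characterisation from the context):
  -- |E| = 2|V(E)| - 2 and every nonempty proper subset F' of E
  -- satisfies |F'| ≤ 2|V(F')| - 3.
  IsRigidityCircuit : Set
  IsRigidityCircuit =
    (∣ ⊤ {m} ∣ + 2 ≡ 2 ℕ.* ∣ VS ⊤ ∣)
    × (∀ (F : Subset m) → Nonempty F → F ⊂ ⊤ → ∣ F ∣ + 3 ≤ 2 ℕ.* ∣ VS F ∣)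

  data Walk (T : Subset m) : Fin n → Fin n → Set where
    []  : ∀ {v} → Walk T v v
    fwd : ∀ {w} (i : Fin m) → i ∈ T → Walk T (head i) w → Walk T (tail i) w
    bwd : ∀ {w} (i : Fin m) → i ∈ T → Walk T (tail i) w → Walk T (head i) w

  verts : ∀ {T u v} → Walk T u v → List (Fin n)
  verts {u = u} [] = u ∷ []
  verts {u = u} (fwd i _ p) = u ∷ verts p
  verts {u = u} (bwd i _ p) = u ∷ verts p

  IsPath : ∀ {T u v} → Walk T u v → Set
  IsPath p = Unique (verts p)

  -- signed coefficient of edge f along the walk (+1 per forward traversal,
  -- -1 per backward traversal); on a path this is c_{ef} ∈ {0,1,-1}
  coeff : ∀ {T u v} → Walk T u v → Fin m → ℤ
  coeff [] f = + 0
  coeff (fwd i _ p) f = (if ⌊ i ≟ᶠ f ⌋ then + 1 else + 0) ℤ.+ coeff p f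
  coeff (bwd i _ p) f = (if ⌊ i ≟ᶠ f ⌋ then - (+ 1) else + 0) ℤ.+ coeff p f

  Connected : Subset m → Set
  Connected T = ∀ u v → Walk T u v

  -- spanning tree of V: connected, and minimally so (every edge is a bridge,
  -- i.e. the subgraph is acyclic)
  IsSpanningTree : Subset m → Set
  IsSpanningTree T = Connected T
    × (∀ i → i ∈ T → ¬ Walk (T [ i ]≔ outside) (tail i) (head i))

  IsCoupledSpanningTree : Subset m → Set
  IsCoupledSpanningTree T = IsSpanningTree T × IsSpanningTree (∁ T)

  -- C is (on rows e ∉ T, columns f ∈ T) the matrix c^T_{ef}:
  -- for e = ⟨v,w⟩ ∉ T, row e is the signed indicator of the path in T from v to w.
  IsCoeffMatrix : Subset m → (Fin m → Fin m → ℤ) → Set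
  IsCoeffMatrix T C = ∀ e → e ∉ T →
    Σ (Walk T (tail e) (head e)) λ p → IsPath p × (∀ f → f ∈ T → C e f ≡ coeff p f)

sumOver : ∀ {m} → Subset m → (Fin m → ℤ) → ℤ
sumOver {ℕ.zero} F g = + 0
sumOver {ℕ.suc m} (b ∷ᵥ F) g =
  (if b then g zero else + 0) ℤ.+ sumOver F (λ i → g (suc i))

δ : ∀ {m} → Fin m → Fin m → ℤ
δ i j = if ⌊ i ≟ᶠ j ⌋ then + 1 else + 0

{-# OPTIONS --safe #-}

-- Let B be one of the two trees, A the other one, and y ∈ B. Since y is a bridge of B, the
-- signed number of traversals of y by a walk in B depends only on the ends u, v of the walk:
-- it is φ v − φ u for a potential φ on the vertices. Hence column y of C_B is the coboundary
-- ∇φ(z) = φ(head z) − φ(tail z), and for x ∈ B the sum Σ_{z ∈ A} c^A_{xz} ∇φ(z) telescopes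
-- along the A-path of x to ∇φ(x), the signed number of traversals of y by the one-edge walk x,
-- which is δ_{xy}.

module Submission where

open import Defs
open import Data.Nat using (ℕ)
open import Data.Integer using (ℤ; _*_)
open import Data.Fin using (Fin)
open import Data.Fin.Subset using (Subset; _∈_; ∁)
open import Data.Product using (_×_)
open import Relation.Binary.PropositionalEquality using (_≡_)

open import Data.Bool using (true; false; if_then_else_)
open import Data.Bool.Properties using (if-eta; if-cong-then)
open import Data.Empty using (⊥-elim)
open import Data.Fin using (zero; suc)
open import Data.Fin.Properties using (_≟_; suc-injective)
open import Data.Fin.Subset using (_∉_; outside)
open import Data.Fin.Subset.Properties using (x∈p⇒x∉∁p; x∈∁p⇒x∉p)
open import Data.Integer using (0ℤ; 1ℤ; -1ℤ; _+_; _-_)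
open import Data.Integer.Properties using (+-identityˡ; +-identityʳ; +-assoc; +-inverseʳ; *-distribʳ-+)
open import Data.Integer.Tactic.RingSolver using (solve-∀)
open import Data.Product using (_,_; proj₁; proj₂)
open import Data.Vec using ([]; _∷_; here; there; _[_]≔_)
open import Data.Vec.Properties using (updateAt-minimal)
open import Function using (_∘_)
open import Relation.Nullary using (¬_; yes; no)
open import Relation.Nullary.Decidable using (⌊_⌋; isYes≗does; dec-true; dec-false)
open import Relation.Binary.PropositionalEquality using (_≢_; refl; sym; trans; cong; cong₂; subst)
open Relation.Binary.PropositionalEquality.≡-Reasoning

if-≟-refl : ∀ {m} (i : Fin m) {x y : ℤ} → (if ⌊ i ≟ i ⌋ then x else y) ≡ x
if-≟-refl i = cong (if_then _ else _) (trans (isYes≗does (i ≟ i)) (dec-true (i ≟ i) refl))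

if-≟-≢ : ∀ {m} {i j : Fin m} {x y : ℤ} → i ≢ j → (if ⌊ i ≟ j ⌋ then x else y) ≡ y
if-≟-≢ {i = i} {j} i≢j =
  cong (if_then _ else _) (trans (isYes≗does (i ≟ j)) (dec-false (i ≟ j) i≢j))

sumOver-cong : ∀ {m} (A : Subset m) {g h : Fin m → ℤ} →
               (∀ z → z ∈ A → g z ≡ h z) → sumOver A g ≡ sumOver A h
sumOver-cong []          g≗h = refl
sumOver-cong (true ∷ A)  g≗h =
  cong₂ _+_ (g≗h zero here) (sumOver-cong A (λ z z∈A → g≗h (suc z) (there z∈A)))
sumOver-cong (false ∷ A) g≗h =
  cong (0ℤ +_) (sumOver-cong A (λ z z∈A → g≗h (suc z) (there z∈A)))

sumOver-zero : ∀ {m} (A : Subset m) {w : Fin m → ℤ} → (∀ z → w z ≡ 0ℤ) → sumOver A w ≡ 0ℤ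
sumOver-zero []      w≡0 = refl
sumOver-zero (b ∷ A) w≡0 =
  cong₂ _+_ (trans (if-cong-then b (w≡0 zero)) (if-eta b)) (sumOver-zero A (w≡0 ∘ suc))

sumOver-+ : ∀ {m} (A : Subset m) (g h : Fin m → ℤ) →
            sumOver A (λ z → g z + h z) ≡ sumOver A g + sumOver A h
sumOver-+ []          g h = refl
sumOver-+ (true ∷ A)  g h = begin
  (g zero + h zero) + sumOver A (λ z → g (suc z) + h (suc z))
    ≡⟨ cong ((g zero + h zero) +_) (sumOver-+ A (g ∘ suc) (h ∘ suc)) ⟩
  (g zero + h zero) + (sumOver A (g ∘ suc) + sumOver A (h ∘ suc))
    ≡⟨ interchange (g zero) (h zero) (sumOver A (g ∘ suc)) (sumOver A (h ∘ suc)) ⟩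
  (g zero + sumOver A (g ∘ suc)) + (h zero + sumOver A (h ∘ suc)) ∎
  where
  interchange : ∀ a b c d → (a + b) + (c + d) ≡ (a + c) + (b + d)
  interchange = solve-∀
sumOver-+ (false ∷ A) g h = begin
  0ℤ + sumOver A (λ z → g (suc z) + h (suc z))
    ≡⟨ +-identityˡ _ ⟩
  sumOver A (λ z → g (suc z) + h (suc z))
    ≡⟨ sumOver-+ A (g ∘ suc) (h ∘ suc) ⟩
  sumOver A (g ∘ suc) + sumOver A (h ∘ suc)
    ≡⟨ sym (cong₂ _+_ (+-identityˡ (sumOver A (g ∘ suc))) (+-identityˡ (sumOver A (h ∘ suc)))) ⟩
  (0ℤ + sumOver A (g ∘ suc)) + (0ℤ + sumOver A (h ∘ suc)) ∎

sumOver-single : ∀ {m} (A : Subset m) (w : Fin m → ℤ) {i} → i ∈ A →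
                 (∀ z → z ≢ i → w z ≡ 0ℤ) → sumOver A w ≡ w i
sumOver-single (true ∷ A) w {zero}  here        w≡0 =
  trans (cong (w zero +_) (sumOver-zero A (λ z → w≡0 (suc z) λ ()))) (+-identityʳ _)
sumOver-single (b ∷ A)    w {suc i} (there i∈A) w≡0 =
  trans (cong₂ _+_ (trans (if-cong-then b (w≡0 zero λ ())) (if-eta b))
                   (sumOver-single A (w ∘ suc) i∈A (λ z z≢i → w≡0 (suc z) (z≢i ∘ suc-injective))))
        (+-identityˡ _)

sumOver-point : ∀ {m} (A : Subset m) {i} (c : ℤ) (h : Fin m → ℤ) → i ∈ A →
                sumOver A (λ z → (if ⌊ i ≟ z ⌋ then c else 0ℤ) * h z) ≡ c * h i
sumOver-point A {i} c h i∈A = trans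
  (sumOver-single A _ i∈A (λ z z≢i → cong (_* h z) (if-≟-≢ (z≢i ∘ sym))))
  (cong (_* h i) (if-≟-refl i))

sumOver-step : ∀ {m} (A : Subset m) {i} (c : ℤ) (a h : Fin m → ℤ) → i ∈ A →
               sumOver A (λ z → ((if ⌊ i ≟ z ⌋ then c else 0ℤ) + a z) * h z)
               ≡ c * h i + sumOver A (λ z → a z * h z)
sumOver-step {m} A {i} c a h i∈A = begin
  sumOver A (λ z → (indicator z + a z) * h z)
    ≡⟨ sumOver-cong A (λ z _ → *-distribʳ-+ (h z) (indicator z) (a z)) ⟩
  sumOver A (λ z → indicator z * h z + a z * h z)
    ≡⟨ sumOver-+ A (λ z → indicator z * h z) (λ z → a z * h z) ⟩
  sumOver A (λ z → indicator z * h z) + sumOver A (λ z → a z * h z)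
    ≡⟨ cong (_+ sumOver A (λ z → a z * h z)) (sumOver-point A c h i∈A) ⟩
  c * h i + sumOver A (λ z → a z * h z) ∎
  where
  indicator : Fin m → ℤ
  indicator z = if ⌊ i ≟ z ⌋ then c else 0ℤ

module _ {n m : ℕ} (G : OGraph n m) where
  open OGraph G

  _++_ : ∀ {T u v w} → Walk G T u v → Walk G T v w → Walk G T u w
  []          ++ q = q
  fwd i i∈T p ++ q = fwd i i∈T (p ++ q)
  bwd i i∈T p ++ q = bwd i i∈T (p ++ q)

  reverse : ∀ {T u v} → Walk G T u v → Walk G T v u
  reverse []            = []
  reverse (fwd i i∈T p) = reverse p ++ bwd i i∈T []
  reverse (bwd i i∈T p) = reverse p ++ fwd i i∈T []

  coeff-++ : ∀ {T u v w} (p : Walk G T u v) (q : Walk G T v w) f →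
             coeff G (p ++ q) f ≡ coeff G p f + coeff G q f
  coeff-++ []            q f = sym (+-identityˡ _)
  coeff-++ (fwd i i∈T p) q f =
    trans (cong (δ i f +_) (coeff-++ p q f)) (sym (+-assoc (δ i f) _ _))
  coeff-++ (bwd i i∈T p) q f =
    trans (cong (backward +_) (coeff-++ p q f)) (sym (+-assoc backward _ _))
    where
    backward : ℤ
    backward = if ⌊ i ≟ f ⌋ then -1ℤ else 0ℤ

  ∇ : (Fin n → ℤ) → Fin m → ℤ
  ∇ φ z = φ (head z) - φ (tail z)

  sumOver-coeff-∇ : ∀ {A s t} (φ : Fin n → ℤ) (p : Walk G A s t) →
                    sumOver A (λ z → coeff G p z * ∇ φ z) ≡ φ t - φ s
  sumOver-coeff-∇ {A} φ [] = trans (sumOver-zero A (λ _ → refl)) (sym (+-inverseʳ (φ _)))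
  sumOver-coeff-∇ {A} {t = t} φ (fwd i i∈A p) = begin
    sumOver A (λ z → coeff G (fwd i i∈A p) z * ∇ φ z)
      ≡⟨ sumOver-step A 1ℤ (coeff G p) (∇ φ) i∈A ⟩
    1ℤ * ∇ φ i + sumOver A (λ z → coeff G p z * ∇ φ z)
      ≡⟨ cong (1ℤ * ∇ φ i +_) (sumOver-coeff-∇ φ p) ⟩
    1ℤ * (φ (head i) - φ (tail i)) + (φ t - φ (head i))
      ≡⟨ telescope (φ (head i)) (φ (tail i)) (φ t) ⟩
    φ t - φ (tail i) ∎
    where
    telescope : ∀ a b c → 1ℤ * (a - b) + (c - a) ≡ c - b
    telescope = solve-∀
  sumOver-coeff-∇ {A} {t = t} φ (bwd i i∈A p) = begin
    sumOver A (λ z → coeff G (bwd i i∈A p) z * ∇ φ z)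
      ≡⟨ sumOver-step A -1ℤ (coeff G p) (∇ φ) i∈A ⟩
    -1ℤ * ∇ φ i + sumOver A (λ z → coeff G p z * ∇ φ z)
      ≡⟨ cong (-1ℤ * ∇ φ i +_) (sumOver-coeff-∇ φ p) ⟩
    -1ℤ * (φ (head i) - φ (tail i)) + (φ t - φ (tail i))
      ≡⟨ telescope (φ (head i)) (φ (tail i)) (φ t) ⟩
    φ t - φ (head i) ∎
    where
    telescope : ∀ a b c → -1ℤ * (a - b) + (c - b) ≡ c - a
    telescope = solve-∀

  module _ (B : Subset m) (y : Fin m) where
    private
      B∖y : Subset m
      B∖y = B [ y ]≔ outside

    -- A walk in B cut at its traversals of y, indexed by their signed number; two successive
    -- traversals in the same direction are joined by a walk in B∖y, closing a cycle through y.
    data Split (u v : Fin n) : ℤ → Set where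
      avoids   : Walk G B∖y u v → Split u v 0ℤ
      crosses⁺ : Walk G B∖y u (tail y) → Walk G B∖y (head y) v → Split u v 1ℤ
      crosses⁻ : Walk G B∖y u (head y) → Walk G B∖y (tail y) v → Split u v -1ℤ
      cycle    : ∀ {c} → Walk G B∖y (tail y) (head y) → Split u v c

    prepend : ∀ {u w v c} → Walk G B∖y u w → Split w v c → Split u v c
    prepend p (avoids q)     = avoids (p ++ q)
    prepend p (crosses⁺ q r) = crosses⁺ (p ++ q) r
    prepend p (crosses⁻ q r) = crosses⁻ (p ++ q) r
    prepend p (cycle q)      = cycle q

    cross⁺ : ∀ {v c} → Split (head y) v c → Split (tail y) v (1ℤ + c)
    cross⁺ (avoids q)     = crosses⁺ [] q
    cross⁺ (crosses⁺ q r) = cycle (reverse q)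
    cross⁺ (crosses⁻ q r) = avoids r
    cross⁺ (cycle q)      = cycle q

    cross⁻ : ∀ {v c} → Split (tail y) v c → Split (head y) v (-1ℤ + c)
    cross⁻ (avoids q)     = crosses⁻ [] q
    cross⁻ (crosses⁺ q r) = avoids r
    cross⁻ (crosses⁻ q r) = cycle q
    cross⁻ (cycle q)      = cycle q

    split : ∀ {u v} (p : Walk G B u v) → Split u v (coeff G p y)
    split []            = avoids []
    split (fwd i i∈B p) with i ≟ y
    ... | yes refl = cross⁺ (split p)
    ... | no  i≢y  = subst (Split _ _) (sym (+-identityˡ _))
                       (prepend (fwd i (updateAt-minimal i y B i≢y i∈B) []) (split p))
    split (bwd i i∈B p) with i ≟ y
    ... | yes refl = cross⁻ (split p)
    ... | no  i≢y  = subst (Split _ _) (sym (+-identityˡ _))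
                       (prepend (bwd i (updateAt-minimal i y B i≢y i∈B) []) (split p))

    split-closed : ∀ {u c} → ¬ Walk G B∖y (tail y) (head y) → Split u u c → c ≡ 0ℤ
    split-closed bridge (avoids _)     = refl
    split-closed bridge (crosses⁺ q r) = ⊥-elim (bridge (reverse (r ++ q)))
    split-closed bridge (crosses⁻ q r) = ⊥-elim (bridge (r ++ q))
    split-closed bridge (cycle q)      = ⊥-elim (bridge q)

    coeff-closed-bridge : ¬ Walk G B∖y (tail y) (head y) →
                          ∀ {u} (p : Walk G B u u) → coeff G p y ≡ 0ℤ
    coeff-closed-bridge bridge p = split-closed bridge (split p)

    coeff-bridge-exact : ¬ Walk G B∖y (tail y) (head y) → (conn : Connected G B) (r : Fin n) →
                         ∀ {u v} (p : Walk G B u v) →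
                         coeff G p y ≡ coeff G (conn r v) y - coeff G (conn r u) y
    coeff-bridge-exact bridge conn r {u} {v} p = begin
      coeff G p y
        ≡⟨ eliminate (coeff G p y) φu φv ψv ⟩
      (φu + (coeff G p y + ψv)) - (φv + ψv) + (φv - φu)
        ≡⟨ cong₂ (λ a b → a - b + (φv - φu)) round-trip-via-p round-trip ⟩
      0ℤ - 0ℤ + (φv - φu)
        ≡⟨ +-identityˡ (φv - φu) ⟩
      φv - φu ∎
      where
      φu φv ψv : ℤ
      φu = coeff G (conn r u) y
      φv = coeff G (conn r v) y
      ψv = coeff G (conn v r) y
      eliminate : ∀ x a b c → x ≡ (a + (x + c)) - (b + c) + (b - a)
      eliminate = solve-∀
      round-trip-via-p : φu + (coeff G p y + ψv) ≡ 0ℤ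
      round-trip-via-p = begin
        φu + (coeff G p y + ψv)
          ≡⟨ cong (φu +_) (sym (coeff-++ p (conn v r) y)) ⟩
        φu + coeff G (p ++ conn v r) y
          ≡⟨ sym (coeff-++ (conn r u) (p ++ conn v r) y) ⟩
        coeff G (conn r u ++ (p ++ conn v r)) y
          ≡⟨ coeff-closed-bridge bridge (conn r u ++ (p ++ conn v r)) ⟩
        0ℤ ∎
      round-trip : φv + ψv ≡ 0ℤ
      round-trip = trans (sym (coeff-++ (conn r v) (conn v r) y))
                         (coeff-closed-bridge bridge (conn r v ++ conn v r))

  coeffMatrix-inverse : (A B : Subset m) → IsSpanningTree G B → (∀ z → z ∈ A → z ∉ B) →
                        (CA CB : Fin m → Fin m → ℤ) →
                        IsCoeffMatrix G A CA → IsCoeffMatrix G B CB →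
                        ∀ x y → x ∈ B → y ∈ B → sumOver A (λ z → CA x z * CB z y) ≡ δ x y
  coeffMatrix-inverse A B (conn , acyclic) disjoint CA CB CA-paths CB-paths x y x∈B y∈B = begin
    sumOver A (λ z → CA x z * CB z y)
      ≡⟨ sumOver-cong A (λ z z∈A → cong₂ _*_ (CA-entry z z∈A) (CB-entry z z∈A)) ⟩
    sumOver A (λ z → coeff G P z * ∇ φ z)
      ≡⟨ sumOver-coeff-∇ φ P ⟩
    ∇ φ x
      ≡⟨ sym (exact (fwd x x∈B [])) ⟩
    coeff G (fwd x x∈B []) y
      ≡⟨ +-identityʳ (δ x y) ⟩
    δ x y ∎
    where
    x∉A : x ∉ A
    x∉A x∈A = disjoint x x∈A x∈B
    P : Walk G A (tail x) (head x)
    P = proj₁ (CA-paths x x∉A)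
    CA-entry : ∀ z → z ∈ A → CA x z ≡ coeff G P z
    CA-entry = proj₂ (proj₂ (CA-paths x x∉A))
    φ : Fin n → ℤ
    φ v = coeff G (conn (tail y) v) y
    exact : ∀ {u v} (p : Walk G B u v) → coeff G p y ≡ φ v - φ u
    exact = coeff-bridge-exact B y (acyclic y y∈B) conn (tail y)
    CB-entry : ∀ z → z ∈ A → CB z y ≡ ∇ φ z
    CB-entry z z∈A with CB-paths z (disjoint z z∈A)
    ... | Q , _ , CB≡coeff = trans (CB≡coeff y y∈B) (exact Q)

mainTheorem2 : ∀ {n m : ℕ} (G : OGraph n m) → IsSimpleSupported G
    → IsRigidityCircuit G
    → (T : Subset m) → IsCoupledSpanningTree G T
    → (CT CS : Fin m → Fin m → ℤ)
    → IsCoeffMatrix G T CT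
    → IsCoeffMatrix G (∁ T) CS
    → (∀ e e′ → e ∈ ∁ T → e′ ∈ ∁ T → sumOver T (λ f → CT e f * CS f e′) ≡ δ e e′)
    × (∀ f f′ → f ∈ T → f′ ∈ T → sumOver (∁ T) (λ e → CS f e * CT e f′) ≡ δ f f′)
mainTheorem2 G _ _ T (T-tree , S-tree) CT CS CT-paths CS-paths =
    coeffMatrix-inverse G T (∁ T) S-tree (λ _ → x∈p⇒x∉∁p) CT CS CT-paths CS-paths
  , coeffMatrix-inverse G (∁ T) T T-tree (λ _ → x∈∁p⇒x∉p) CS CT CS-paths CT-paths
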